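{- Let $G$ be a finite simple graph, $A_1,A_2$ disjoint subsets of $V(G)$, and $G^*$ the graph obtained by toggling all pairs between $A_1$ and $A_2$, with closed neighborhood matrices $N$ and $N^*$. Suppose $A_1$ is an AO set and $A_2$ is an HO set in $G$. Then for every pattern $\mathbf{p}$, $N^*\mathbf{p}=\mathbf{1}$ if and only if $N\mathbf{p}=\overline{\mathbf{x}_{A_1}}$ and $\mathbf{x}_{A_2}\cdot\mathbf{p}=1$. Moreover, $A_1$ is NO and $A_2$ is AO in $G^*$, and $\nu(G^*)=\nu(G)-1$.
   Context: For a graph $H$ with vertex set $V=\{v_1,\dots,v_n\}$, $N(H)$ is the closed neighborhood matrix over $\mathbb{Z}_2$ (entry $(i,j)$ is $1$ iff $i=j$ or $v_iv_j$ is an edge), $\nu(H)=\dim\ker N(H)$. Given disjoint $A_1,A_2\subseteq V(G)$, $G^*$ is obtained from $G$ by, for every $u\in A_1$, $v\in A_2$, adding the edge $uv$ if $u,v$ are non-adjacent and removing it if they are adjacent; $N=N(G)$, $N^*=N(G^*)$. Subsets $A$ are identified with characteristic vectors $\mathbf{x}_A$; $\mathbf{x}\cdot\mathbf{y}=\mathbf{x}^t\mathbf{y}$ over $\mathbb{Z}_2$; $\mathbf{1}$ is the all-ones vector, $\overline{\mathbf{x}}:=\mathbf{x}+\mathbf{1}$. In a graph $H$ with matrix $M$: a pattern $\mathbf{p}$ solves configuration $\mathbf{c}$ if $M\mathbf{p}=\mathbf{c}$; $\mathbf{c}$ (or a set $A$ via $\mathbf{x}_A$) is solvable if some pattern solves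 it; $\mathbf{1}$ is always solvable. A set $A$ is HO if it is not solvable. For solvable $A$, $A$ is AO if $\mathbf{x}_A\cdot\mathbf{p}=1$ for all $\mathbf{p}$ with $M\mathbf{p}=\mathbf{1}$, and NO if $\mathbf{x}_A\cdot\mathbf{p}=0$ for all such $\mathbf{p}$. -}

module Defs where

open import Data.Nat using (ℕ; zero; suc)
open import Data.Fin using (Fin; zero; suc)
open import Data.Bool using (Bool; true; false; _∧_; _∨_; _xor_; not)
open import Data.Bool.Properties using (∧-comm; ∨-comm; xor-comm)
open import Data.Product using (Σ; _×_; _,_; ∃)
open import Relation.Nullary using (¬_)
open import Relation.Binary.PropositionalEquality using (_≡_; refl; cong₂)
open import Data.Empty using (⊥-elim)

-- Z₂ is modelled by Bool: addition = _xor_, multiplication = _∧_.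

Vec₂ : ℕ → Set
Vec₂ n = Fin n → Bool

Mat₂ : ℕ → Set
Mat₂ n = Fin n → Fin n → Bool

Σ₂ : ∀ {n} → (Fin n → Bool) → Bool
Σ₂ {zero}  f = false
Σ₂ {suc n} f = f zero xor Σ₂ (λ i → f (suc i))

_·_ : ∀ {n} → Vec₂ n → Vec₂ n → Bool
x · y = Σ₂ (λ i → x i ∧ y i)

_⊛_ : ∀ {n} → Mat₂ n → Vec₂ n → Vec₂ n
(M ⊛ p) i = Σ₂ (λ j → M i j ∧ p j)

𝟏 : ∀ {n} → Vec₂ n
𝟏 _ = true

𝟎 : ∀ {n} → Vec₂ n
𝟎 _ = false

‾ : ∀ {n} → Vec₂ n → Vec₂ n
‾ x i = x i xor true

_≗₂_ : ∀ {n} → Vec₂ n → Vec₂ n → Set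
x ≗₂ y = ∀ i → x i ≡ y i

record Graph (n : ℕ) : Set where
  field
    adj   : Fin n → Fin n → Bool
    sym   : ∀ u v → adj u v ≡ adj v u
    irrefl : ∀ u → adj u u ≡ false
open Graph public

-- Subsets of V are identified with characteristic vectors.
Subset₂ : ℕ → Set
Subset₂ n = Vec₂ n

Disjoint : ∀ {n} → Subset₂ n → Subset₂ n → Set
Disjoint A₁ A₂ = ∀ i → ¬ (A₁ i ≡ true × A₂ i ≡ true)

eqFin : ∀ {n} → Fin n → Fin n → Bool
eqFin zero    zero    = true
eqFin zero    (suc _) = false
eqFin (suc _) zero    = false
eqFin (suc i) (suc j) = eqFin i j

N : ∀ {n} → Graph n → Mat₂ n
N H i j = eqFin i j ∨ adj H i j

cross : ∀ {n} → Subset₂ n → Subset₂ n → Fin n → Fin n → Bool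
cross A₁ A₂ u v = (A₁ u ∧ A₂ v) ∨ (A₂ u ∧ A₁ v)

private
  cross-sym : ∀ {n} (A₁ A₂ : Subset₂ n) u v → cross A₁ A₂ u v ≡ cross A₁ A₂ v u
  cross-sym A₁ A₂ u v with A₁ u | A₂ u | A₁ v | A₂ v
  ... | false | false | false | false = refl
  ... | false | false | false | true = refl
  ... | false | false | true | false = refl
  ... | false | false | true | true = refl
  ... | false | true | false | false = refl
  ... | false | true | false | true = refl
  ... | false | true | true | false = refl
  ... | false | true | true | true = refl
  ... | true | false | false | false = refl
  ... | true | false | false | true = refl
  ... | true | false | true | false = refl
  ... | true | false | true | true = refl
  ... | true | true | false | false = refl
  ... | true | true | false | true = refl
  ... | true | true | true | false = refl
  ... | true | true | true | true = refl

  cross-diag : ∀ {n} (A₁ A₂ : Subset₂ n) → Disjoint A₁ A₂ → ∀ u → cross A₁ A₂ u u ≡ false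
  cross-diag A₁ A₂ dj u with A₁ u in e₁ | A₂ u in e₂
  ... | false | false = refl
  ... | false | true  = refl
  ... | true  | false = refl
  ... | true  | true  = ⊥-elim (dj u (e₁ , e₂))

toggle : ∀ {n} (G : Graph n) (A₁ A₂ : Subset₂ n) → Disjoint A₁ A₂ → Graph n
toggle G A₁ A₂ dj = record
  { adj    = λ u v → adj G u v xor cross A₁ A₂ u v
  ; sym    = λ u v → cong₂ _xor_ (sym G u v) (cross-sym A₁ A₂ u v)
  ; irrefl = λ u → cong₂ _xor_ (irrefl G u) (cross-diag A₁ A₂ dj u)
  }

Solves : ∀ {n} → Mat₂ n → Vec₂ n → Vec₂ n → Set
Solves M p c = (M ⊛ p) ≗₂ c

Solvable : ∀ {n} → Mat₂ n → Vec₂ n → Set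
Solvable M c = ∃ λ p → Solves M p c

HO : ∀ {n} → Mat₂ n → Subset₂ n → Set
HO M A = ¬ Solvable M A

AO : ∀ {n} → Mat₂ n → Subset₂ n → Set
AO M A = Solvable M A × (∀ p → Solves M p 𝟏 → A · p ≡ true)

NO : ∀ {n} → Mat₂ n → Subset₂ n → Set
NO M A = Solvable M A × (∀ p → Solves M p 𝟏 → A · p ≡ false)

-- Linear algebra over Z₂: dim ker M = d  iff  ker M has a basis of d vectors.
lincomb : ∀ {n d} → (Fin d → Bool) → (Fin d → Vec₂ n) → Vec₂ n
lincomb c B i = Σ₂ (λ k → c k ∧ B k i)

IsKerBasis : ∀ {n d} → Mat₂ n → (Fin d → Vec₂ n) → Set
IsKerBasis {n} {d} M B =
    (∀ k → (M ⊛ B k) ≗₂ 𝟎)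
  × (∀ (c : Fin d → Bool) → lincomb c B ≗₂ 𝟎 → ∀ k → c k ≡ false)
  × (∀ (v : Vec₂ n) → (M ⊛ v) ≗₂ 𝟎 → ∃ λ (c : Fin d → Bool) → lincomb c B ≗₂ v)

KerDim : ∀ {n} → Mat₂ n → ℕ → Set
KerDim {n} M d = Σ (Fin d → Vec₂ n) (IsKerBasis M)

-- Over Z₂ the toggle is a symmetric rank-two update: N* p = N p + (A₂ · p) A₁ + (A₁ · p) A₂. Fix q with
-- N q = A₁. By symmetry A₁ · p = q · N p, and since p · N p = 𝟏 · p for every p (which also gives
-- Sutner's theorem that 𝟏 is solvable), the AO hypothesis yields q · 𝟏 = q · A₁ = 1. As A₂ is not solvable,
-- the Fredholm alternative provides k ∈ ker N with A₂ · k = 1. Now if N* p = c with c solvable in G, then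
-- A₁ · p = 0 (otherwise A₂ would be solvable), hence N p = (q · c) A₁ + c and A₂ · p = q · c. The case c = 𝟏
-- describes the all-ones solutions of G*, the case c = A₁ (solved by k) shows A₁ is NO, and the case c = 𝟎
-- shows ker N* = ker N ∩ A₂⊥, a hyperplane of ker N because A₂ · k = 1.
module Submission where

open import Defs hiding (sym)
open import Data.Nat using (ℕ; zero; suc; _∸_)
open import Data.Bool using (Bool; true; false; not; _∧_; _∨_; _xor_)
open import Data.Bool.Properties
  using ( ∧-comm; ∧-assoc; ∧-zeroʳ; ∧-identityʳ; ∧-distribˡ-xor; ∧-distribʳ-xor; ∧-commutativeMonoid
        ; ∨-identityʳ; xor-assoc; xor-comm; xor-same; xor-identityʳ; xor-inverseˡ; xor-inverseʳ
        ; xor-∧-commutativeRing; ¬-not )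
open import Data.Fin using (Fin; zero; suc; punchIn)
open import Data.Product using (Σ; _×_; _,_; ∃; proj₁; proj₂)
open import Data.Sum using (_⊎_; inj₁; inj₂)
open import Data.Empty using (⊥-elim)
open import Data.Vec.Functional using (_∷_; tail; insertAt; removeAt)
open import Data.Vec.Functional.Properties using (insertAt-lookup; insertAt-punchIn)
open import Function using (_∘_)
open import Function.Bundles using (_⇔_; mk⇔; Equivalence)
open import Function.Properties.Equivalence using () renaming (sym to ⇔-sym)
open import Relation.Binary.PropositionalEquality
  using (_≡_; refl; sym; trans; cong; cong₂; subst; module ≡-Reasoning)
open import Algebra.Bundles using (CommutativeRing; CommutativeMonoid)
open import Algebra.Properties.CommutativeSemigroup
  (CommutativeRing.+-commutativeSemigroup xor-∧-commutativeRing)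
  using () renaming (interchange to xor-interchange; x∙yz≈y∙xz to xor-left-comm)
open import Algebra.Properties.CommutativeSemigroup
  (CommutativeMonoid.commutativeSemigroup ∧-commutativeMonoid)
  using () renaming (x∙yz≈y∙xz to ∧-left-comm)

open ≡-Reasoning
open Equivalence using (to; from)

xor-cancelʳ : ∀ x y → (x xor y) xor y ≡ x
xor-cancelʳ false y = xor-same y
xor-cancelʳ true  y = xor-inverseˡ y

xor-cancelˡ : ∀ x y → x xor (x xor y) ≡ y
xor-cancelˡ x y = trans (xor-comm x (x xor y)) (trans (cong (_xor x) (xor-comm x y)) (xor-cancelʳ y x))

xor-moveʳ : ∀ {x y z} → x xor y ≡ z → x ≡ z xor y
xor-moveʳ {x} {y} refl = sym (xor-cancelʳ x y)

∧≡true⇒ʳ : ∀ x {y} → x ∧ y ≡ true → y ≡ true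
∧≡true⇒ʳ true y≡true = y≡true

Σ₂-cong : ∀ {n} {f g : Fin n → Bool} → (∀ i → f i ≡ g i) → Σ₂ f ≡ Σ₂ g
Σ₂-cong {zero}  f≗g = refl
Σ₂-cong {suc n} f≗g = cong₂ _xor_ (f≗g zero) (Σ₂-cong (f≗g ∘ suc))

Σ₂-𝟎 : ∀ n → Σ₂ (𝟎 {n}) ≡ false
Σ₂-𝟎 zero    = refl
Σ₂-𝟎 (suc n) = Σ₂-𝟎 n

Σ₂-xor : ∀ {n} (f g : Fin n → Bool) → Σ₂ (λ i → f i xor g i) ≡ Σ₂ f xor Σ₂ g
Σ₂-xor {zero}  f g = refl
Σ₂-xor {suc n} f g =
  trans (cong ((f zero xor g zero) xor_) (Σ₂-xor (f ∘ suc) (g ∘ suc)))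
        (xor-interchange (f zero) (g zero) (Σ₂ (f ∘ suc)) (Σ₂ (g ∘ suc)))

Σ₂-∧ˡ : ∀ {n} b (f : Fin n → Bool) → Σ₂ (λ i → b ∧ f i) ≡ b ∧ Σ₂ f
Σ₂-∧ˡ {zero}  b f = sym (∧-zeroʳ b)
Σ₂-∧ˡ {suc n} b f =
  trans (cong ((b ∧ f zero) xor_) (Σ₂-∧ˡ b (f ∘ suc))) (sym (∧-distribˡ-xor b (f zero) (Σ₂ (f ∘ suc))))

Σ₂-swap : ∀ {m n} (f : Fin m → Fin n → Bool) → Σ₂ (λ i → Σ₂ (f i)) ≡ Σ₂ (λ j → Σ₂ (λ i → f i j))
Σ₂-swap {zero}  {n} f = sym (Σ₂-𝟎 n)
Σ₂-swap {suc m}     f =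
  trans (cong (Σ₂ (f zero) xor_) (Σ₂-swap (f ∘ suc))) (sym (Σ₂-xor (f zero) (λ j → Σ₂ (λ i → f (suc i) j))))

Σ₂-punchIn : ∀ {n} (j : Fin (suc n)) (f : Fin (suc n) → Bool) → Σ₂ f ≡ f j xor Σ₂ (f ∘ punchIn j)
Σ₂-punchIn         zero    f = refl
Σ₂-punchIn {suc n} (suc j) f =
  trans (cong (f zero xor_) (Σ₂-punchIn j (f ∘ suc))) (xor-left-comm (f zero) (f (suc j)) _)

Σ₂-true : ∀ {n} (f : Fin n → Bool) → Σ₂ f ≡ true → ∃ λ j → f j ≡ true
Σ₂-true {zero}  f ()
Σ₂-true {suc n} f Σf≡true with f zero in f₀≡
... | true  = zero , f₀≡
... | false = let j , fj≡true = Σ₂-true (f ∘ suc) Σf≡true in suc j , fj≡true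

infixl 6 _⊕_
infixr 7 _⊙_

_⊕_ : ∀ {n} → Vec₂ n → Vec₂ n → Vec₂ n
(x ⊕ y) i = x i xor y i

_⊙_ : ∀ {n} → Bool → Vec₂ n → Vec₂ n
(b ⊙ x) i = b ∧ x i

·-comm : ∀ {n} (x y : Vec₂ n) → x · y ≡ y · x
·-comm x y = Σ₂-cong λ i → ∧-comm (x i) (y i)

·-congˡ : ∀ {n} {x x′ : Vec₂ n} (y : Vec₂ n) → x ≗₂ x′ → x · y ≡ x′ · y
·-congˡ y x≗x′ = Σ₂-cong λ i → cong (_∧ y i) (x≗x′ i)

·-congʳ : ∀ {n} (x : Vec₂ n) {y y′ : Vec₂ n} → y ≗₂ y′ → x · y ≡ x · y′
·-congʳ x y≗y′ = Σ₂-cong λ i → cong (x i ∧_) (y≗y′ i)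

·-𝟎ʳ : ∀ {n} (x : Vec₂ n) → x · 𝟎 ≡ false
·-𝟎ʳ {n} x = trans (Σ₂-cong λ i → ∧-zeroʳ (x i)) (Σ₂-𝟎 n)

·-⊕ʳ : ∀ {n} (x y z : Vec₂ n) → x · (y ⊕ z) ≡ x · y xor x · z
·-⊕ʳ x y z = trans (Σ₂-cong λ i → ∧-distribˡ-xor (x i) (y i) (z i))
                   (Σ₂-xor (λ i → x i ∧ y i) (λ i → x i ∧ z i))

·-⊕ˡ : ∀ {n} (x y z : Vec₂ n) → (x ⊕ y) · z ≡ x · z xor y · z
·-⊕ˡ x y z = trans (Σ₂-cong λ i → ∧-distribʳ-xor (z i) (x i) (y i))
                   (Σ₂-xor (λ i → x i ∧ z i) (λ i → y i ∧ z i))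

·-⊕ʳ-cancel : ∀ {n} (x y z : Vec₂ n) → x · y ≡ x · (y ⊕ z) xor x · z
·-⊕ʳ-cancel x y z = xor-moveʳ (sym (·-⊕ʳ x y z))

·-⊙ʳ : ∀ {n} (x : Vec₂ n) b (y : Vec₂ n) → x · (b ⊙ y) ≡ b ∧ x · y
·-⊙ʳ x b y = trans (Σ₂-cong λ i → ∧-left-comm (x i) b (y i)) (Σ₂-∧ˡ b (λ i → x i ∧ y i))

·-⊙ˡ : ∀ {n} b (x y : Vec₂ n) → (b ⊙ x) · y ≡ b ∧ x · y
·-⊙ˡ b x y = trans (Σ₂-cong λ i → ∧-assoc b (x i) (y i)) (Σ₂-∧ˡ b (λ i → x i ∧ y i))

·-lincomb : ∀ {n d} (x : Vec₂ n) (c : Fin d → Bool) (B : Fin d → Vec₂ n) →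
            x · lincomb c B ≡ c · (λ k → x · B k)
·-lincomb x c B = begin
  Σ₂ (λ i → x i ∧ Σ₂ (λ k → c k ∧ B k i))    ≡⟨ Σ₂-cong (λ i → sym (Σ₂-∧ˡ (x i) (λ k → c k ∧ B k i))) ⟩
  Σ₂ (λ i → Σ₂ (λ k → x i ∧ (c k ∧ B k i)))  ≡⟨ Σ₂-swap (λ i k → x i ∧ (c k ∧ B k i)) ⟩
  Σ₂ (λ k → Σ₂ (λ i → x i ∧ (c k ∧ B k i)))  ≡⟨ Σ₂-cong (λ k → Σ₂-cong λ i → ∧-left-comm (x i) (c k) (B k i)) ⟩
  Σ₂ (λ k → Σ₂ (λ i → c k ∧ (x i ∧ B k i)))  ≡⟨ Σ₂-cong (λ k → Σ₂-∧ˡ (c k) (λ i → x i ∧ B k i)) ⟩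
  Σ₂ (λ k → c k ∧ Σ₂ (λ i → x i ∧ B k i))    ∎

lincomb-removeAt : ∀ {n d} (j : Fin (suc d)) (e : Fin (suc d) → Bool) (B : Fin (suc d) → Vec₂ n) →
                   lincomb e B ≗₂ (e j ⊙ B j ⊕ lincomb (removeAt e j) (removeAt B j))
lincomb-removeAt j e B i = Σ₂-punchIn j (λ k → e k ∧ B k i)

lincomb-shear : ∀ {n d} (c t : Fin d → Bool) (u : Fin d → Vec₂ n) (w : Vec₂ n) →
                lincomb c (λ k → u k ⊕ t k ⊙ w) ≗₂ ((c · t) ⊙ w ⊕ lincomb c u)
lincomb-shear c t u w i = begin
  Σ₂ (λ k → c k ∧ (u k i xor t k ∧ w i))            ≡⟨ Σ₂-cong summand ⟩
  Σ₂ (λ k → (c k ∧ u k i) xor (w i ∧ (c k ∧ t k)))  ≡⟨ Σ₂-xor (λ k → c k ∧ u k i) (λ k → w i ∧ (c k ∧ t k)) ⟩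
  lincomb c u i xor Σ₂ (λ k → w i ∧ (c k ∧ t k))    ≡⟨ cong (lincomb c u i xor_) (Σ₂-∧ˡ (w i) (λ k → c k ∧ t k)) ⟩
  lincomb c u i xor (w i ∧ c · t)                   ≡⟨ xor-comm (lincomb c u i) (w i ∧ c · t) ⟩
  (w i ∧ c · t) xor lincomb c u i                   ≡⟨ cong (_xor lincomb c u i) (∧-comm (w i) (c · t)) ⟩
  (c · t ∧ w i) xor lincomb c u i                   ∎
  where
  summand : ∀ k → c k ∧ (u k i xor t k ∧ w i) ≡ (c k ∧ u k i) xor (w i ∧ (c k ∧ t k))
  summand k = trans (∧-distribˡ-xor (c k) (u k i) (t k ∧ w i))
                    (cong ((c k ∧ u k i) xor_) (trans (sym (∧-assoc (c k) (t k) (w i))) (∧-comm _ (w i))))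

solves-resp : ∀ {n} (M : Mat₂ n) {p c c′ : Vec₂ n} → c ≗₂ c′ → Solves M p c → Solves M p c′
solves-resp M c≗c′ Mp≗c i = trans (Mp≗c i) (c≗c′ i)

solves-⊕ : ∀ {n} (M : Mat₂ n) {p p′ c c′ : Vec₂ n} →
           Solves M p c → Solves M p′ c′ → Solves M (p ⊕ p′) (c ⊕ c′)
solves-⊕ M {p} {p′} Mp≗c Mp′≗c′ i = trans (·-⊕ʳ (M i) p p′) (cong₂ _xor_ (Mp≗c i) (Mp′≗c′ i))

solves-⊙ : ∀ {n} (M : Mat₂ n) {p c : Vec₂ n} b → Solves M p c → Solves M (b ⊙ p) (b ⊙ c)
solves-⊙ M {p} b Mp≗c i = trans (·-⊙ʳ (M i) b p) (cong (b ∧_) (Mp≗c i))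

solves-⊕-cancelˡ : ∀ {n} (M : Mat₂ n) {p p′ c d : Vec₂ n} →
                   Solves M p (c ⊕ d) → Solves M p′ c → Solves M (p ⊕ p′) d
solves-⊕-cancelˡ M {c = c} {d} Mp≗c⊕d Mp′≗c =
  solves-resp M (λ i → trans (xor-comm (c i xor d i) (c i)) (xor-cancelˡ (c i) (d i)))
                (solves-⊕ M Mp≗c⊕d Mp′≗c)

Kernel : ∀ {n} → Mat₂ n → Vec₂ n → Set
Kernel M v = Solves M v 𝟎

IsSymmetric : ∀ {n} → Mat₂ n → Set
IsSymmetric M = ∀ i j → M i j ≡ M j i

⊛≗lincomb : ∀ {n} {M : Mat₂ n} → IsSymmetric M → (p : Vec₂ n) → (M ⊛ p) ≗₂ lincomb p M
⊛≗lincomb {M = M} M-sym p i = Σ₂-cong λ j → trans (∧-comm (M i j) (p j)) (cong (p j ∧_) (M-sym i j))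

·-⊛-swap : ∀ {n} {M : Mat₂ n} → IsSymmetric M → (x y : Vec₂ n) → x · (M ⊛ y) ≡ y · (M ⊛ x)
·-⊛-swap {M = M} M-sym x y = begin
  x · (M ⊛ y)          ≡⟨ ·-congʳ x (⊛≗lincomb M-sym y) ⟩
  x · lincomb y M      ≡⟨ ·-lincomb x y M ⟩
  y · (λ k → x · M k)  ≡⟨ ·-congʳ y (λ k → ·-comm x (M k)) ⟩
  y · (M ⊛ x)          ∎

-- Off-diagonal terms of the quadratic form cancel in pairs by symmetry.
p·[M⊛p]≡𝟏·p : ∀ {n} {M : Mat₂ n} → IsSymmetric M → (∀ i → M i i ≡ true) → (p : Vec₂ n) →
              p · (M ⊛ p) ≡ 𝟏 · p
p·[M⊛p]≡𝟏·p {zero}          M-sym M-diag p = refl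
p·[M⊛p]≡𝟏·p {suc n} {M = M} M-sym M-diag p = begin
  (p₀ ∧ ((M zero zero ∧ p₀) xor r · p′)) xor p′ · (c ⊕ M′ ⊛ p′)
    ≡⟨ cong₂ (λ d s → (p₀ ∧ ((d ∧ p₀) xor r · p′)) xor s) (M-diag zero) (·-⊕ʳ p′ c (M′ ⊛ p′)) ⟩
  (p₀ ∧ (p₀ xor r · p′)) xor (p′ · c xor p′ · (M′ ⊛ p′))
    ≡⟨ cong (λ s → (p₀ ∧ (p₀ xor r · p′)) xor (s xor p′ · (M′ ⊛ p′))) p′·c≡p₀∧r·p′ ⟩
  (p₀ ∧ (p₀ xor r · p′)) xor ((p₀ ∧ r · p′) xor p′ · (M′ ⊛ p′))
    ≡⟨ cong (λ s → (p₀ ∧ (p₀ xor r · p′)) xor ((p₀ ∧ r · p′) xor s))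
            (p·[M⊛p]≡𝟏·p (λ i j → M-sym (suc i) (suc j)) (M-diag ∘ suc) p′) ⟩
  (p₀ ∧ (p₀ xor r · p′)) xor ((p₀ ∧ r · p′) xor 𝟏 · p′)
    ≡⟨ absorb p₀ (r · p′) (𝟏 · p′) ⟩
  p₀ xor 𝟏 · p′
    ∎
  where
  p₀ : Bool
  p₀ = p zero
  p′ r : Vec₂ n
  p′ = tail p
  r  = tail (M zero)
  M′ : Mat₂ n
  M′ i j = M (suc i) (suc j)
  c : Vec₂ n
  c i = M (suc i) zero ∧ p₀

  p′·c≡p₀∧r·p′ : p′ · c ≡ p₀ ∧ r · p′
  p′·c≡p₀∧r·p′ = begin
    p′ · c         ≡⟨ ·-congʳ p′ (λ i → trans (∧-comm _ p₀) (cong (p₀ ∧_) (M-sym (suc i) zero))) ⟩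
    p′ · (p₀ ⊙ r)  ≡⟨ ·-⊙ʳ p′ p₀ r ⟩
    p₀ ∧ p′ · r    ≡⟨ cong (p₀ ∧_) (·-comm p′ r) ⟩
    p₀ ∧ r · p′    ∎

  absorb : ∀ a s t → (a ∧ (a xor s)) xor ((a ∧ s) xor t) ≡ a xor t
  absorb false s t = refl
  absorb true  s t = trans (sym (xor-assoc (not s) s t)) (cong (_xor t) (xor-inverseˡ s))

InSpan : ∀ {m n} → (Fin m → Vec₂ n) → Vec₂ n → Set
InSpan v c = ∃ λ l → lincomb l v ≗₂ c

SeparatedFromSpan : ∀ {m n} → (Fin m → Vec₂ n) → Vec₂ n → Set
SeparatedFromSpan v c = ∃ λ y → (∀ j → y · v j ≡ false) × y · c ≡ true

null-or-detected : ∀ {n} (c : Vec₂ n) → c ≗₂ 𝟎 ⊎ ∃ λ y → y · c ≡ true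
null-or-detected {zero}  c = inj₁ λ ()
null-or-detected {suc n} c with c zero in c₀≡ | null-or-detected (tail c)
... | true  | _                  = inj₂ (true ∷ 𝟎 , cong not (Σ₂-𝟎 n))
... | false | inj₁ c′≗𝟎         = inj₁ λ { zero → c₀≡ ; (suc i) → c′≗𝟎 i }
... | false | inj₂ (y , y·c′≡true) = inj₂ (false ∷ y , y·c′≡true)

separated-cons : ∀ {m n} {v : Fin (suc m) → Vec₂ n} {c : Vec₂ n} (y : Vec₂ n) →
                 (∀ j → y · v (suc j) ≡ false) → y · v zero ≡ false → y · c ≡ true → SeparatedFromSpan v c
separated-cons y y⊥v′ y⊥v₀ y·c≡true = y , (λ { zero → y⊥v₀ ; (suc j) → y⊥v′ j }) , y·c≡true

-- The Fredholm alternative over Z₂, by induction on the number of vectors: if y separates c from the span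
-- of the tail but not from v₀, then either c ⊕ v₀ lies in that span, or a separator y′ of c ⊕ v₀ repairs y.
inSpan-or-separated : ∀ {m n} (v : Fin m → Vec₂ n) (c : Vec₂ n) → InSpan v c ⊎ SeparatedFromSpan v c
inSpan-or-separated {zero} v c with null-or-detected c
... | inj₁ c≗𝟎            = inj₁ ((λ ()) , λ i → sym (c≗𝟎 i))
... | inj₂ (y , y·c≡true) = inj₂ (y , (λ ()) , y·c≡true)
inSpan-or-separated {suc m} v c with inSpan-or-separated (tail v) c
... | inj₁ (l , l≗c) = inj₁ (false ∷ l , l≗c)
... | inj₂ (y , y⊥v′ , y·c≡true) with y · v zero in y·v₀≡ | inSpan-or-separated (tail v) (c ⊕ v zero)
...   | false | _ = inj₂ (separated-cons y y⊥v′ y·v₀≡ y·c≡true)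
...   | true  | inj₁ (l , l≗c⊕v₀) =
  inj₁ (true ∷ l , λ i → trans (cong (v zero i xor_) (l≗c⊕v₀ i))
                                (trans (xor-comm (v zero i) _) (xor-cancelʳ (c i) (v zero i))))
...   | true  | inj₂ (y′ , y′⊥v′ , y′·[c⊕v₀]≡true)
  with y′ · v zero in y′·v₀≡ | trans (·-⊕ʳ-cancel y′ c (v zero)) (cong (_xor y′ · v zero) y′·[c⊕v₀]≡true)
...     | false | y′·c≡true  = inj₂ (separated-cons y′ y′⊥v′ y′·v₀≡ y′·c≡true)
...     | true  | y′·c≡false = inj₂ (separated-cons (y ⊕ y′)
                                 (λ j → trans (·-⊕ˡ y y′ _) (cong₂ _xor_ (y⊥v′ j) (y′⊥v′ j)))
                                 (trans (·-⊕ˡ y y′ _) (cong₂ _xor_ y·v₀≡ y′·v₀≡))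
                                 (trans (·-⊕ˡ y y′ c) (cong₂ _xor_ y·c≡true y′·c≡false)))

solvable-or-detected : ∀ {n} {M : Mat₂ n} → IsSymmetric M → (c : Vec₂ n) →
                       Solvable M c ⊎ ∃ λ y → Kernel M y × c · y ≡ true
solvable-or-detected {M = M} M-sym c with inSpan-or-separated M c
... | inj₁ (l , l≗c)             = inj₁ (l , λ i → trans (⊛≗lincomb M-sym l i) (l≗c i))
... | inj₂ (y , y⊥M , y·c≡true) =
  inj₂ (y , (λ i → trans (·-comm (M i) y) (y⊥M i)) , trans (·-comm c y) y·c≡true)

𝟏-solvable : ∀ {n} {M : Mat₂ n} → IsSymmetric M → (∀ i → M i i ≡ true) → Solvable M 𝟏
𝟏-solvable {M = M} M-sym M-diag with solvable-or-detected M-sym 𝟏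
... | inj₁ solvable                = solvable
... | inj₂ (y , My≗𝟎 , 𝟏·y≡true) with () ← begin
  false        ≡⟨ sym (·-𝟎ʳ y) ⟩
  y · 𝟎        ≡⟨ sym (·-congʳ y My≗𝟎) ⟩
  y · (M ⊛ y)  ≡⟨ p·[M⊛p]≡𝟏·p M-sym M-diag y ⟩
  𝟏 · y        ≡⟨ 𝟏·y≡true ⟩
  true         ∎

Independent : ∀ {n d} → (Fin d → Vec₂ n) → Set
Independent B = ∀ c → lincomb c B ≗₂ 𝟎 → ∀ k → c k ≡ false

IsBasis : ∀ {n d} → (Vec₂ n → Set) → (Fin d → Vec₂ n) → Set
IsBasis W B = (∀ k → W (B k)) × Independent B × (∀ v → W v → InSpan B v)

Dim : ∀ {n} → (Vec₂ n → Set) → ℕ → Set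
Dim {n} W d = Σ (Fin d → Vec₂ n) (IsBasis W)

Dim-resp : ∀ {n d} {W W′ : Vec₂ n → Set} → (∀ v → W v ⇔ W′ v) → Dim W d → Dim W′ d
Dim-resp W⇔W′ (B , B⊆W , B-indep , B-spans) =
  B , (λ k → to (W⇔W′ (B k)) (B⊆W k)) , B-indep , λ v v∈W′ → B-spans v (from (W⇔W′ v) v∈W′)

basis-detects : ∀ {n d} {W : Vec₂ n → Set} {B : Fin d → Vec₂ n} {k : Vec₂ n} (x : Vec₂ n) →
                IsBasis W B → W k → x · k ≡ true → ∃ λ j → x · B j ≡ true
basis-detects {B = B} {k} x (_ , _ , B-spans) k∈W x·k≡true with B-spans k k∈W
... | e , e≗k with Σ₂-true _ (trans (sym (·-lincomb x e B)) (trans (·-congʳ x e≗k) x·k≡true))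
...   | j , ej∧x·Bj≡true = j , ∧≡true⇒ʳ (e j) ej∧x·Bj≡true

Hyperplane : ∀ {n} → Mat₂ n → Vec₂ n → Vec₂ n → Set
Hyperplane M x v = Kernel M v × x · v ≡ false

hyperplane-basis : ∀ {n d} {M : Mat₂ n} (x : Vec₂ n) {B : Fin (suc d) → Vec₂ n} →
                   IsBasis (Kernel M) B → (j : Fin (suc d)) → x · B j ≡ true →
                   IsBasis (Hyperplane M x) (λ k → removeAt B j k ⊕ (x · removeAt B j k) ⊙ B j)
hyperplane-basis {n} {d} {M} x {B} (B⊆ker , B-indep , B-spans) j x·Bj≡true = C⊆H , C-indep , C-spans
  where
  t : Fin d → Bool
  t k = x · removeAt B j k

  C : Fin d → Vec₂ n
  C k = removeAt B j k ⊕ t k ⊙ B j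

  C⊆H : ∀ k → Hyperplane M x (C k)
  C⊆H k = solves-resp M (λ i → ∧-zeroʳ (t k))
                        (solves-⊕ M (B⊆ker (punchIn j k)) (solves-⊙ M (t k) (B⊆ker j)))
        , (begin
            x · C k                                ≡⟨ ·-⊕ʳ x _ _ ⟩
            t k xor x · (t k ⊙ B j)                ≡⟨ cong (t k xor_) (·-⊙ʳ x (t k) (B j)) ⟩
            t k xor (t k ∧ x · B j)                ≡⟨ cong (λ s → t k xor (t k ∧ s)) x·Bj≡true ⟩
            t k xor (t k ∧ true)                   ≡⟨ cong (t k xor_) (∧-identityʳ (t k)) ⟩
            t k xor t k                            ≡⟨ xor-same (t k) ⟩
            false                                  ∎)

  C-indep : Independent C
  C-indep c Σc≗𝟎 k = trans (sym (insertAt-punchIn c j (c · t) k)) (B-indep c′ c′-null (punchIn j k))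
    where
    c′ : Fin (suc d) → Bool
    c′ = insertAt c j (c · t)
    c′-null : lincomb c′ B ≗₂ 𝟎
    c′-null i = begin
      lincomb c′ B i                                          ≡⟨ lincomb-removeAt j c′ B i ⟩
      (c′ j ∧ B j i) xor lincomb (removeAt c′ j) (removeAt B j) i
        ≡⟨ cong₂ (λ s l → (s ∧ B j i) xor l) (insertAt-lookup c j (c · t))
                 (Σ₂-cong λ k → cong (_∧ B (punchIn j k) i) (insertAt-punchIn c j (c · t) k)) ⟩
      ((c · t) ∧ B j i) xor lincomb c (removeAt B j) i
        ≡⟨ sym (lincomb-shear c t (removeAt B j) (B j) i) ⟩
      lincomb c C i                                           ≡⟨ Σc≗𝟎 i ⟩
      false                                                   ∎

  C-spans : ∀ v → Hyperplane M x v → InSpan C v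
  C-spans v (v∈ker , x·v≡false) with B-spans v v∈ker
  ... | e , e≗v = removeAt e j , λ i → begin
    lincomb (removeAt e j) C i
      ≡⟨ lincomb-shear (removeAt e j) t (removeAt B j) (B j) i ⟩
    (removeAt e j · t ∧ B j i) xor lincomb (removeAt e j) (removeAt B j) i
      ≡⟨ cong (λ s → (s ∧ B j i) xor lincomb (removeAt e j) (removeAt B j) i) (sym ej≡e′·t) ⟩
    (e j ∧ B j i) xor lincomb (removeAt e j) (removeAt B j) i   ≡⟨ sym (lincomb-removeAt j e B i) ⟩
    lincomb e B i                                               ≡⟨ e≗v i ⟩
    v i                                                         ∎
    where
    ej≡e′·t : e j ≡ removeAt e j · t
    ej≡e′·t = xor-moveʳ (begin
      e j xor removeAt e j · t               ≡⟨ cong (_xor removeAt e j · t) (sym (∧-identityʳ (e j))) ⟩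
      (e j ∧ true) xor removeAt e j · t      ≡⟨ cong (λ s → (e j ∧ s) xor removeAt e j · t) (sym x·Bj≡true) ⟩
      (e j ∧ x · B j) xor removeAt e j · t   ≡⟨ sym (Σ₂-punchIn j (λ k → e k ∧ x · B k)) ⟩
      e · (λ k → x · B k)                    ≡⟨ sym (·-lincomb x e B) ⟩
      x · lincomb e B                        ≡⟨ ·-congʳ x e≗v ⟩
      x · v                                  ≡⟨ x·v≡false ⟩
      false                                  ∎)

hyperplane-dim : ∀ {n d} {M : Mat₂ n} (x : Vec₂ n) → Dim (Kernel M) d →
                 (∃ λ k → Kernel M k × x · k ≡ true) → Dim (Hyperplane M x) (d ∸ 1)
hyperplane-dim {d = zero} x (B , B-basis) (k , k∈ker , x·k≡true)
  with () ← proj₁ (basis-detects x B-basis k∈ker x·k≡true)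
hyperplane-dim {d = suc d} x (B , B-basis) (k , k∈ker , x·k≡true) =
  let j , x·Bj≡true = basis-detects x B-basis k∈ker x·k≡true in _ , hyperplane-basis x B-basis j x·Bj≡true

eqFin-refl : ∀ {n} (i : Fin n) → eqFin i i ≡ true
eqFin-refl zero    = refl
eqFin-refl (suc i) = eqFin-refl i

eqFin-sym : ∀ {n} (i j : Fin n) → eqFin i j ≡ eqFin j i
eqFin-sym zero    zero    = refl
eqFin-sym zero    (suc j) = refl
eqFin-sym (suc i) zero    = refl
eqFin-sym (suc i) (suc j) = eqFin-sym i j

eqFin⇒≡ : ∀ {n} (i j : Fin n) → eqFin i j ≡ true → i ≡ j
eqFin⇒≡ zero    zero    _   = refl
eqFin⇒≡ (suc i) (suc j) i=j = cong suc (eqFin⇒≡ i j i=j)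

N-symmetric : ∀ {n} (G : Graph n) → IsSymmetric (N G)
N-symmetric G i j = cong₂ _∨_ (eqFin-sym i j) (Graph.sym G i j)

N-diagonal : ∀ {n} (G : Graph n) → ∀ i → N G i i ≡ true
N-diagonal G i = cong (_∨ adj G i i) (eqFin-refl i)

N-𝟏-solvable : ∀ {n} (G : Graph n) → Solvable (N G) 𝟏
N-𝟏-solvable G = 𝟏-solvable (N-symmetric G) (N-diagonal G)

module Toggle {n} (G : Graph n) (A₁ A₂ : Subset₂ n) (dj : Disjoint A₁ A₂) where

  G* : Graph n
  G* = toggle G A₁ A₂ dj

  disjoint-∧ : ∀ i → A₁ i ∧ A₂ i ≡ false
  disjoint-∧ i with A₁ i in A₁i | A₂ i in A₂i
  ... | true  | true  = ⊥-elim (dj i (A₁i , A₂i))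
  ... | true  | false = refl
  ... | false | _     = refl

  cross≡xor : ∀ i j → cross A₁ A₂ i j ≡ (A₁ i ∧ A₂ j) xor (A₂ i ∧ A₁ j)
  cross≡xor i j with A₁ i in A₁i | A₂ i in A₂i
  ... | true  | true  = ⊥-elim (dj i (A₁i , A₂i))
  ... | true  | false = trans (∨-identityʳ (A₂ j)) (sym (xor-identityʳ (A₂ j)))
  ... | false | _     = refl

  N-toggle : ∀ i → N G* i ≗₂ (N G i ⊕ (A₁ i ⊙ A₂ ⊕ A₂ i ⊙ A₁))
  N-toggle i j with eqFin i j in i=j
  ... | false = cong (adj G i j xor_) (cross≡xor i j)
  ... | true with refl ← eqFin⇒≡ i j i=j =
    sym (cong not (cong₂ _xor_ (disjoint-∧ i) (trans (∧-comm (A₂ i) (A₁ i)) (disjoint-∧ i))))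

  toggle-⊛ : ∀ p → (N G* ⊛ p) ≗₂ (N G ⊛ p ⊕ ((A₂ · p) ⊙ A₁ ⊕ (A₁ · p) ⊙ A₂))
  toggle-⊛ p i = begin
    N G* i · p                                             ≡⟨ ·-congˡ p (N-toggle i) ⟩
    (N G i ⊕ (A₁ i ⊙ A₂ ⊕ A₂ i ⊙ A₁)) · p                   ≡⟨ ·-⊕ˡ (N G i) _ p ⟩
    N G i · p xor (A₁ i ⊙ A₂ ⊕ A₂ i ⊙ A₁) · p                ≡⟨ cong (N G i · p xor_) (·-⊕ˡ (A₁ i ⊙ A₂) _ p) ⟩
    N G i · p xor ((A₁ i ⊙ A₂) · p xor (A₂ i ⊙ A₁) · p)      ≡⟨ cong (N G i · p xor_) (cong₂ _xor_
                                                                 (trans (·-⊙ˡ (A₁ i) A₂ p) (∧-comm (A₁ i) _))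
                                                                 (trans (·-⊙ˡ (A₂ i) A₁ p) (∧-comm (A₂ i) _))) ⟩
    N G i · p xor ((A₂ · p ∧ A₁ i) xor (A₁ · p ∧ A₂ i))      ∎

  solves-toggle⇔ : ∀ {p c : Vec₂ n} {a b} → A₂ · p ≡ a → A₁ · p ≡ b →
                   Solves (N G*) p c ⇔ Solves (N G) p (c ⊕ (a ⊙ A₁ ⊕ b ⊙ A₂))
  solves-toggle⇔ {p} {c} refl refl = mk⇔
    (λ M*p≗c i → xor-moveʳ (trans (sym (toggle-⊛ p i)) (M*p≗c i)))
    (λ Mp≗ i → trans (toggle-⊛ p i) (trans (cong (_xor _) (Mp≗ i)) (xor-cancelʳ (c i) _)))

  module AO-HO (A₁-AO : AO (N G) A₁) (A₂-HO : HO (N G) A₂) where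

    q : Vec₂ n
    q = proj₁ (proj₁ A₁-AO)

    Mq≗A₁ : Solves (N G) q A₁
    Mq≗A₁ = proj₂ (proj₁ A₁-AO)

    A₁·≡q·⊛ : ∀ p → A₁ · p ≡ q · (N G ⊛ p)
    A₁·≡q·⊛ p = begin
      A₁ · p            ≡⟨ ·-congˡ p (λ i → sym (Mq≗A₁ i)) ⟩
      (N G ⊛ q) · p     ≡⟨ ·-comm (N G ⊛ q) p ⟩
      p · (N G ⊛ q)     ≡⟨ ·-⊛-swap (N-symmetric G) p q ⟩
      q · (N G ⊛ p)     ∎

    q·𝟏≡true : q · 𝟏 ≡ true
    q·𝟏≡true with N-𝟏-solvable G
    ... | p , Mp≗𝟏 = begin
      q · 𝟏          ≡⟨ ·-congʳ q (λ i → sym (Mp≗𝟏 i)) ⟩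
      q · (N G ⊛ p)  ≡⟨ sym (A₁·≡q·⊛ p) ⟩
      A₁ · p         ≡⟨ proj₂ A₁-AO p Mp≗𝟏 ⟩
      true           ∎

    q·A₁≡true : q · A₁ ≡ true
    q·A₁≡true = begin
      q · A₁         ≡⟨ ·-congʳ q (λ i → sym (Mq≗A₁ i)) ⟩
      q · (N G ⊛ q)  ≡⟨ p·[M⊛p]≡𝟏·p (N-symmetric G) (N-diagonal G) q ⟩
      𝟏 · q          ≡⟨ ·-comm 𝟏 q ⟩
      q · 𝟏          ≡⟨ q·𝟏≡true ⟩
      true           ∎

    kernel-detects-A₂ : ∃ λ k → Kernel (N G) k × A₂ · k ≡ true
    kernel-detects-A₂ with solvable-or-detected (N-symmetric G) A₂
    ... | inj₁ A₂-solvable = ⊥-elim (A₂-HO A₂-solvable)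
    ... | inj₂ detected    = detected

    A₁-orthogonal : ∀ {p c : Vec₂ n} → Solvable (N G) c → Solves (N G*) p c → A₁ · p ≡ false
    A₁-orthogonal {p} (s , Ms≗c) M*p≗c = ¬-not λ A₁·p≡true →
      A₂-HO (p ⊕ s ⊕ (A₂ · p) ⊙ q ,
             solves-⊕-cancelˡ (N G)
               (solves-⊕-cancelˡ (N G) (to (solves-toggle⇔ refl A₁·p≡true) M*p≗c) Ms≗c)
               (solves-⊙ (N G) (A₂ · p) Mq≗A₁))

    A₁·solution : ∀ {p} (c : Vec₂ n) a → Solves (N G) p (a ⊙ A₁ ⊕ c) → A₁ · p ≡ a xor q · c
    A₁·solution {p} c a Mp≗ = begin
      A₁ · p                      ≡⟨ A₁·≡q·⊛ p ⟩
      q · (N G ⊛ p)               ≡⟨ ·-congʳ q Mp≗ ⟩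
      q · (a ⊙ A₁ ⊕ c)            ≡⟨ ·-⊕ʳ q (a ⊙ A₁) c ⟩
      q · (a ⊙ A₁) xor q · c      ≡⟨ cong (_xor q · c) (·-⊙ʳ q a A₁) ⟩
      (a ∧ q · A₁) xor q · c      ≡⟨ cong (λ s → (a ∧ s) xor q · c) q·A₁≡true ⟩
      (a ∧ true) xor q · c        ≡⟨ cong (_xor q · c) (∧-identityʳ a) ⟩
      a xor q · c                 ∎

    solves-toggle⇔-via-q : ∀ {p c : Vec₂ n} {a} → Solvable (N G) c → q · c ≡ a →
                           Solves (N G*) p c ⇔ (Solves (N G) p (a ⊙ A₁ ⊕ c) × A₂ · p ≡ a)
    solves-toggle⇔-via-q {p} {c} {a} c-solvable q·c≡a = mk⇔ forward backward
      where
      drop-𝟎 : ∀ a′ → (c ⊕ (a′ ⊙ A₁ ⊕ false ⊙ A₂)) ≗₂ (a′ ⊙ A₁ ⊕ c)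
      drop-𝟎 a′ i = trans (cong (c i xor_) (xor-identityʳ (a′ ∧ A₁ i))) (xor-comm (c i) (a′ ∧ A₁ i))

      forward : Solves (N G*) p c → Solves (N G) p (a ⊙ A₁ ⊕ c) × A₂ · p ≡ a
      forward M*p≗c = subst (λ a′ → Solves (N G) p (a′ ⊙ A₁ ⊕ c)) A₂·p≡a Mp≗ , A₂·p≡a
        where
        A₁·p≡false : A₁ · p ≡ false
        A₁·p≡false = A₁-orthogonal c-solvable M*p≗c
        Mp≗ : Solves (N G) p ((A₂ · p) ⊙ A₁ ⊕ c)
        Mp≗ = solves-resp (N G) (drop-𝟎 (A₂ · p)) (to (solves-toggle⇔ refl A₁·p≡false) M*p≗c)
        A₂·p≡a : A₂ · p ≡ a
        A₂·p≡a = trans (xor-moveʳ (trans (sym (A₁·solution c (A₂ · p) Mp≗)) A₁·p≡false)) q·c≡a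

      backward : Solves (N G) p (a ⊙ A₁ ⊕ c) × A₂ · p ≡ a → Solves (N G*) p c
      backward (Mp≗ , A₂·p≡a) =
        from (solves-toggle⇔ A₂·p≡a A₁·p≡false) (solves-resp (N G) (λ i → sym (drop-𝟎 a i)) Mp≗)
        where
        A₁·p≡false : A₁ · p ≡ false
        A₁·p≡false = trans (A₁·solution c a Mp≗) (trans (cong (a xor_) q·c≡a) (xor-same a))

    all-ones-solutions-toggle : ∀ p → Solves (N G*) p 𝟏 ⇔ (Solves (N G) p (‾ A₁) × A₂ · p ≡ true)
    all-ones-solutions-toggle p = solves-toggle⇔-via-q (N-𝟏-solvable G) q·𝟏≡true

    kernel-toggle : ∀ v → Hyperplane (N G) A₂ v ⇔ Kernel (N G*) v
    kernel-toggle v = ⇔-sym (solves-toggle⇔-via-q (𝟎 , λ i → ·-𝟎ʳ (N G i)) (·-𝟎ʳ q))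

    A₁-NO-toggle : NO (N G*) A₁
    A₁-NO-toggle with kernel-detects-A₂
    ... | k , Mk≗𝟎 , A₂·k≡true =
      (k , from (solves-toggle⇔-via-q (q , Mq≗A₁) q·A₁≡true)
                ((λ i → trans (Mk≗𝟎 i) (sym (xor-same (A₁ i)))) , A₂·k≡true))
      , λ p M*p≗𝟏 → A₁-orthogonal (N-𝟏-solvable G) M*p≗𝟏

    A₂-AO-toggle : AO (N G*) A₂
    A₂-AO-toggle with kernel-detects-A₂
    ... | k , Mk≗𝟎 , A₂·k≡true =
      (r , from (solves-toggle⇔ A₂·r≡true A₁·r≡true)
                (solves-resp (N G) (λ i → sym (trans (xor-comm (A₂ i) _) (xor-cancelʳ (A₁ i) (A₂ i)))) Mr≗A₁))
      , λ p M*p≗𝟏 → proj₂ (to (all-ones-solutions-toggle p) M*p≗𝟏)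
      where
      t : Bool
      t = not (A₂ · q)
      r : Vec₂ n
      r = q ⊕ t ⊙ k
      Mr≗A₁ : Solves (N G) r A₁
      Mr≗A₁ = solves-resp (N G) (λ i → trans (cong (A₁ i xor_) (∧-zeroʳ t)) (xor-identityʳ (A₁ i)))
                (solves-⊕ (N G) Mq≗A₁ (solves-⊙ (N G) t Mk≗𝟎))
      A₂·r≡true : A₂ · r ≡ true
      A₂·r≡true = begin
        A₂ · r                       ≡⟨ ·-⊕ʳ A₂ q (t ⊙ k) ⟩
        A₂ · q xor A₂ · (t ⊙ k)      ≡⟨ cong (A₂ · q xor_) (·-⊙ʳ A₂ t k) ⟩
        A₂ · q xor (t ∧ A₂ · k)      ≡⟨ cong (λ s → A₂ · q xor (t ∧ s)) A₂·k≡true ⟩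
        A₂ · q xor (t ∧ true)        ≡⟨ cong (A₂ · q xor_) (∧-identityʳ t) ⟩
        A₂ · q xor not (A₂ · q)      ≡⟨ xor-inverseʳ (A₂ · q) ⟩
        true                         ∎
      A₁·r≡true : A₁ · r ≡ true
      A₁·r≡true = trans (A₁·≡q·⊛ r) (trans (·-congʳ q Mr≗A₁) q·A₁≡true)

mainTheorem16 : ∀ {n} (G : Graph n) (A₁ A₂ : Subset₂ n) (dj : Disjoint A₁ A₂) →
    AO (N G) A₁ → HO (N G) A₂ →
      (∀ (p : Vec₂ n) →
        Solves (N (toggle G A₁ A₂ dj)) p 𝟏 ⇔ (Solves (N G) p (‾ A₁) × A₂ · p ≡ true))
    × NO (N (toggle G A₁ A₂ dj)) A₁
    × AO (N (toggle G A₁ A₂ dj)) A₂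
    × (∀ (d : ℕ) → KerDim (N G) d → KerDim (N (toggle G A₁ A₂ dj)) (d ∸ 1))
mainTheorem16 G A₁ A₂ dj A₁-AO A₂-HO =
    all-ones-solutions-toggle
  , A₁-NO-toggle
  , A₂-AO-toggle
  , λ d dim → Dim-resp kernel-toggle (hyperplane-dim A₂ dim kernel-detects-A₂)
  where open Toggle.AO-HO G A₁ A₂ dj A₁-AO A₂-HO
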